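{- Let $r$ be an odd positive integer and let $n = 2^{\alpha}p_1^{\alpha_1}p_2^{\alpha_2}\cdots p_s^{\alpha_s}$, where $p_1,\ldots,p_s$ are distinct odd primes each greater than $r$, and $\alpha,\alpha_1,\ldots,\alpha_s$ are positive integers, such that $2^t p_1^{\gamma} + r$ is composite for all $t\in\{1,\ldots,\alpha\}$ and $\gamma\in\{1,\ldots,\alpha_1\}$. For each such $t,\gamma$ let $q_{t,\gamma}$ be a prime divisor of $2^t p_1^{\gamma}+r$, and let $M$ be the least common multiple of all the $q_{t,\gamma}$. If $p_i \equiv 1 \pmod M$ for all $i\in\{2,\ldots,s\}$ and $p_1 - r \nmid n$, then $n$ is a Schemmel nontotient number of order $r$.
   Context: For a positive integer $r$, the Schemmel totient function $S_r$ is the multiplicative arithmetic function determined by $S_r(p^{\alpha}) = 0$ if $p \le r$ and $S_r(p^{\alpha}) = p^{\alpha-1}(p-r)$ if $p > r$, for all primes $p$ and positive integers $\alpha$ (and $S_r(1)=1$). A Schemmel nontotient number of order $r$ is a positive integer not in the range of $S_r$. -}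

module Defs where

open import Data.Nat using (ℕ; zero; suc; _+_; _*_; _∸_; _^_; _≤_; _<_)
open import Data.Nat.Primality using (Prime)
open import Data.Nat.LCM using (lcm)
open import Data.Nat.Properties using (_≤?_)
open import Data.List using (List; []; _∷_; map; foldr)
open import Data.Nat.ListAction using (product)
open import Data.List.Relation.Unary.All using (All)
open import Data.List.Relation.Unary.Unique.Propositional using (Unique)
open import Data.Product using (_×_; _,_; proj₁; ∃-syntax)
open import Relation.Nullary using (¬_; yes; no)
open import Relation.Binary.PropositionalEquality using (_≡_)

Factorisation : Set
Factorisation = List (ℕ × ℕ)

ppow : ℕ × ℕ → ℕ
ppow (p , a) = p ^ a

factValue : Factorisation → ℕ
factValue fs = product (map ppow fs)

-- fs is a valid prime factorisation of m: distinct primes, positive exponents,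
-- product equal to m.  (m = 1 ↔ empty list.)
IsFactorisation : ℕ → Factorisation → Set
IsFactorisation m fs =
  All (λ pa → Prime (proj₁ pa)) fs ×
  All (λ pa → 1 ≤ Data.Product.proj₂ pa) fs ×
  Unique (map proj₁ fs) ×
  factValue fs ≡ m

schemmelPP : ℕ → ℕ × ℕ → ℕ
schemmelPP r (p , a) with p ≤? r
... | yes _ = 0
... | no  _ = p ^ (a ∸ 1) * (p ∸ r)

schemmelFact : ℕ → Factorisation → ℕ
schemmelFact r fs = product (map (schemmelPP r) fs)

-- S_r(m) ≡ v  (m ≥ 1), via the (unique) prime factorisation of m.
SchemmelValue : ℕ → ℕ → ℕ → Set
SchemmelValue r m v = ∃[ fs ] (IsFactorisation m fs × schemmelFact r fs ≡ v)

SchemmelNontotient : ℕ → ℕ → Set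
SchemmelNontotient r n = ¬ (∃[ m ] (1 ≤ m × SchemmelValue r m n))

range1 : ℕ → List ℕ
range1 zero = []
range1 (suc k) = range1 k Data.List.++ (suc k ∷ [])

lcmList : List ℕ → ℕ
lcmList = foldr lcm 1

lcmGrid : (ℕ → ℕ → ℕ) → ℕ → ℕ → ℕ
lcmGrid q α α₁ = lcmList (Data.List.concatMap (λ t → map (q t) (range1 α₁)) (range1 α))

{-# OPTIONS --safe #-}

-- Suppose S_r(m) = n. The prime p₁ divides n, hence a factor q^(b-1) (q - r) of S_r(m), where
-- q > r is a prime factor of m. If p₁ = q, then p₁ - r divides n, which is excluded. Otherwise
-- p₁ ∣ q - r ∣ n, and since q and r are odd, q - r = 2^t p₁^γ k with 1 ≤ t ≤ α, 1 ≤ γ ≤ α₁ and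
-- k ∣ p₂^α₂ ⋯ p_s^α_s, so k ≡ 1 (mod M). Then q_{t,γ} divides both 2^t p₁^γ + r and k - 1, hence
-- also q = 2^t p₁^γ (k - 1) + (2^t p₁^γ + r). So q = q_{t,γ} ≤ 2^t p₁^γ + r ≤ q, and the
-- composite number 2^t p₁^γ + r would be the prime q.

module Submission where

open import Defs
open import Data.Nat using (ℕ; _+_; _*_; _∸_; _^_; _≤_; _<_)
open import Data.Nat.Divisibility using (_∣_; _∤_)
open import Data.Nat.Primality using (Prime; Composite)
open import Data.List using (List; _∷_; map)
open import Data.List.Relation.Unary.All using (All)
open import Data.List.Relation.Unary.Unique.Propositional using (Unique)
open import Data.Product using (_×_; _,_; proj₁; proj₂)

open import Function using (_∘_)
open import Data.Empty using (⊥; ⊥-elim)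
open import Data.Sum using (_⊎_; inj₁; inj₂)
open import Data.Product using (∃-syntax)
open import Data.Nat.Base using (zero; suc; NonZero; ≢-nonZero⁻¹; z≤n; s≤s)
open import Data.Nat.Properties
open import Data.Nat.Divisibility
open import Data.Nat.Primality
open import Data.Nat.Coprimality using (Coprime; coprime-divisor)
open import Data.Nat.LCM using (m∣lcm[m,n]; n∣lcm[m,n])
open import Data.Nat.ListAction using (product)
open import Data.Nat.ListAction.Properties using (∈⇒∣product)
open import Data.List using ([])
open import Data.List.Membership.Propositional using (_∈_; lose)
open import Data.List.Membership.Propositional.Properties
  using (∈-map⁺; ∈-map⁻; ∈-++⁺ˡ; ∈-++⁺ʳ; ∈-concatMap⁺)
open import Data.List.Relation.Unary.Any using (here; there)
open import Data.List.Relation.Unary.All using ([]; _∷_)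
import Data.List.Relation.Unary.All as All
open import Data.List.Relation.Unary.Unique.Propositional.Properties using (Unique[x∷xs]⇒x∉xs)
open import Relation.Nullary using (¬_; yes; no)
open import Relation.Binary.PropositionalEquality

n∣n^[1+] : ∀ {n a} → 1 ≤ a → n ∣ n ^ a
n∣n^[1+] (s≤s _) = m∣m*n _

divisor≢0 : ∀ {m n} → .{{NonZero n}} → m ∣ n → NonZero m
divisor≢0 {zero} {n} 0∣n = ⊥-elim (≢-nonZero⁻¹ n (0∣⇒≡0 0∣n))
divisor≢0 {suc m} _ = _

prime∤1 : ∀ {p} → Prime p → p ∤ 1
prime∤1 p-prime p∣1 = ¬prime[1] (subst Prime (∣1⇒≡1 p∣1) p-prime)

prime∣prime⇒≡ : ∀ {p q} → Prime p → Prime q → p ∣ q → p ≡ q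
prime∣prime⇒≡ p-prime q-prime p∣q with prime⇒irreducible q-prime p∣q
... | inj₁ p≡1 = ⊥-elim (¬prime[1] (subst Prime p≡1 p-prime))
... | inj₂ p≡q = p≡q

prime∤⇒coprime : ∀ {p d} → Prime p → p ∤ d → Coprime d p
prime∤⇒coprime p-prime p∤d (i∣d , i∣p) with prime⇒irreducible p-prime i∣p
... | inj₁ i≡1 = i≡1
... | inj₂ refl = ⊥-elim (p∤d i∣d)

prime∣^⇒∣ : ∀ {p m} n → Prime p → p ∣ m ^ n → p ∣ m
prime∣^⇒∣ zero p-prime p∣1 = ⊥-elim (prime∤1 p-prime p∣1)
prime∣^⇒∣ {m = m} (suc n) p-prime p∣m^[1+n] with euclidsLemma m (m ^ n) p-prime p∣m^[1+n]
... | inj₁ p∣m = p∣m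
... | inj₂ p∣m^n = prime∣^⇒∣ n p-prime p∣m^n

prime∤* : ∀ {p m n} → Prime p → p ∤ m → p ∤ n → p ∤ m * n
prime∤* {m = m} {n} p-prime p∤m p∤n p∣m*n with euclidsLemma m n p-prime p∣m*n
... | inj₁ p∣m = p∤m p∣m
... | inj₂ p∣n = p∤n p∣n

prime∣product-map⇒∣ : ∀ {A : Set} {p} (f : A → ℕ) xs → Prime p →
  p ∣ product (map f xs) → ∃[ x ] (x ∈ xs × p ∣ f x)
prime∣product-map⇒∣ f [] p-prime p∣1 = ⊥-elim (prime∤1 p-prime p∣1)
prime∣product-map⇒∣ f (x ∷ xs) p-prime p∣∏ with euclidsLemma (f x) (product (map f xs)) p-prime p∣∏
... | inj₁ p∣fx = x , here refl , p∣fx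
... | inj₂ p∣∏xs with prime∣product-map⇒∣ f xs p-prime p∣∏xs
...   | y , y∈xs , p∣fy = y , there y∈xs , p∣fy

∣p^a*m⇒≡p^t*d : ∀ {p d m} a → Prime p → d ∣ p ^ a * m →
  ∃[ t ] ∃[ d′ ] (t ≤ a × d ≡ p ^ t * d′ × d′ ∣ m)
∣p^a*m⇒≡p^t*d {d = d} {m} zero p-prime d∣1*m =
  0 , d , z≤n , sym (*-identityˡ d) , subst (d ∣_) (*-identityˡ m) d∣1*m
∣p^a*m⇒≡p^t*d {p} {d} {m} (suc a) p-prime d∣p^[1+a]*m with p ∣? d
... | yes (divides c refl) =
  let instance _ = prime⇒nonZero p-prime
      c∣p^a*m = *-cancelˡ-∣ p (subst₂ _∣_ (*-comm c p) (*-assoc p (p ^ a) m) d∣p^[1+a]*m)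
      (t , d′ , t≤a , c≡ , d′∣m) = ∣p^a*m⇒≡p^t*d a p-prime c∣p^a*m
  in suc t , d′ , s≤s t≤a , trans (cong (_* p) c≡) (p^t*d′*p≡p^[1+t]*d′ t d′) , d′∣m
  where
  p^t*d′*p≡p^[1+t]*d′ : ∀ t d′ → p ^ t * d′ * p ≡ p ^ suc t * d′
  p^t*d′*p≡p^[1+t]*d′ t d′ = trans (*-comm (p ^ t * d′) p) (sym (*-assoc p (p ^ t) d′))
... | no p∤d =
  let d∣p^a*m = coprime-divisor (prime∤⇒coprime p-prime p∤d)
                  (subst (d ∣_) (*-assoc p (p ^ a) m) d∣p^[1+a]*m)
      (t , d′ , t≤a , d≡ , d′∣m) = ∣p^a*m⇒≡p^t*d a p-prime d∣p^a*m
  in t , d′ , m≤n⇒m≤1+n t≤a , d≡ , d′∣m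

∣p^a*m⇒≡p^[t≥1]*d : ∀ {p d m} a → Prime p → p ∤ m → p ∣ d → d ∣ p ^ a * m →
  ∃[ t ] ∃[ d′ ] (1 ≤ t × t ≤ a × d ≡ p ^ t * d′ × d′ ∣ m)
∣p^a*m⇒≡p^[t≥1]*d a p-prime p∤m p∣d d∣p^a*m with ∣p^a*m⇒≡p^t*d a p-prime d∣p^a*m
... | zero , d′ , _ , refl , d′∣m =
  ⊥-elim (p∤m (∣-trans p∣d (subst (_∣ _) (sym (*-identityˡ d′)) d′∣m)))
... | suc t , d′ , t≤a , d≡ , d′∣m = suc t , d′ , s≤s z≤n , t≤a , d≡ , d′∣m

even⇒¬odd : ∀ {n} → 2 ∣ n → 2 ∤ n + 1
even⇒¬odd 2∣n 2∣n+1 = prime∤1 prime[2] (∣m+n∣m⇒∣n 2∣n+1 2∣n)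

even⊎odd : ∀ n → 2 ∣ n ⊎ 2 ∣ n + 1
even⊎odd zero = inj₁ (2 ∣0)
even⊎odd (suc n) with even⊎odd n
... | inj₁ 2∣n = inj₂ (subst (2 ∣_) (cong suc (+-comm 1 n)) (∣m∣n⇒∣m+n ∣-refl 2∣n))
... | inj₂ 2∣n+1 = inj₁ (subst (2 ∣_) (+-comm n 1) 2∣n+1)

odd∸odd-even : ∀ {m n} → n ≤ m → 2 ∣ m + 1 → 2 ∣ n + 1 → 2 ∣ m ∸ n
odd∸odd-even {m} {n} n≤m 2∣m+1 2∣n+1 = ∣m+n∣m⇒∣n (subst (2 ∣_) m+1≡ 2∣m+1) 2∣n+1
  where
  open ≡-Reasoning
  m+1≡ : m + 1 ≡ (n + 1) + (m ∸ n)
  m+1≡ = begin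
    m + 1               ≡⟨ cong (_+ 1) (m+[n∸m]≡n n≤m) ⟨
    n + (m ∸ n) + 1     ≡⟨ +-assoc n (m ∸ n) 1 ⟩
    n + ((m ∸ n) + 1)   ≡⟨ cong (n +_) (+-comm (m ∸ n) 1) ⟩
    n + (1 + (m ∸ n))   ≡⟨ +-assoc n 1 (m ∸ n) ⟨
    (n + 1) + (m ∸ n)   ∎

prime⇒≡2⊎odd : ∀ {p} → Prime p → p ≡ 2 ⊎ 2 ∣ p + 1
prime⇒≡2⊎odd {p} p-prime with even⊎odd p
... | inj₁ 2∣p = inj₁ (sym (prime∣prime⇒≡ prime[2] p-prime 2∣p))
... | inj₂ 2∣p+1 = inj₂ 2∣p+1

-- M ∣ x ∸ 1 encodes x ≡ 1 (mod M), except that truncation also admits x = 0.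
∣∸1-* : ∀ {M} x y → M ∣ x ∸ 1 → M ∣ y ∸ 1 → M ∣ x * y ∸ 1
∣∸1-* zero y _ _ = _ ∣0
∣∸1-* (suc x) zero _ _ rewrite *-zeroʳ x = _ ∣0
∣∸1-* (suc x) (suc y) M∣x M∣y = ∣m∣n⇒∣m+n M∣y (∣m⇒∣m*n (suc y) M∣x)

∣∸1-^ : ∀ {M} x n → M ∣ x ∸ 1 → M ∣ x ^ n ∸ 1
∣∸1-^ x zero _ = _ ∣0
∣∸1-^ x (suc n) M∣x∸1 = ∣∸1-* x (x ^ n) M∣x∸1 (∣∸1-^ x n M∣x∸1)

∣∸1-∣factValue : ∀ {M k} fs → All (Prime ∘ proj₁) fs → All (λ pa → M ∣ proj₁ pa ∸ 1) fs →
  k ∣ factValue fs → M ∣ k ∸ 1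
∣∸1-∣factValue [] [] [] k∣1 rewrite ∣1⇒≡1 k∣1 = _ ∣0
∣∸1-∣factValue ((p , a) ∷ fs) (p-prime ∷ primes) (M∣p∸1 ∷ M∣fs) k∣p^a*fs
  with ∣p^a*m⇒≡p^t*d a p-prime k∣p^a*fs
... | t , k′ , _ , refl , k′∣fs =
  ∣∸1-* (p ^ t) k′ (∣∸1-^ p t M∣p∸1) (∣∸1-∣factValue fs primes M∣fs k′∣fs)

factValue≢0 : ∀ fs → All (Prime ∘ proj₁) fs → NonZero (factValue fs)
factValue≢0 [] [] = _
factValue≢0 ((p , a) ∷ fs) (p-prime ∷ primes) =
  m*n≢0 (p ^ a) (factValue fs) {{m^n≢0 p a {{prime⇒nonZero p-prime}}}} {{factValue≢0 fs primes}}

prime∣factValue⇒∈ : ∀ {ℓ} fs → Prime ℓ → All (Prime ∘ proj₁) fs → ℓ ∣ factValue fs →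
  ℓ ∈ map proj₁ fs
prime∣factValue⇒∈ fs ℓ-prime primes ℓ∣fs with prime∣product-map⇒∣ ppow fs ℓ-prime ℓ∣fs
... | (p , a) , pa∈fs , ℓ∣p^a =
  subst (_∈ map proj₁ fs)
    (sym (prime∣prime⇒≡ ℓ-prime (All.lookup primes pa∈fs) (prime∣^⇒∣ a ℓ-prime ℓ∣p^a)))
    (∈-map⁺ proj₁ pa∈fs)

schemmelPP≢0 : ∀ r q b → schemmelPP r (q , b) ≢ 0 →
  r < q × schemmelPP r (q , b) ≡ q ^ (b ∸ 1) * (q ∸ r)
schemmelPP≢0 r q b S≢0 with q ≤? r
... | yes _ = ⊥-elim (S≢0 refl)
... | no q≰r = ≰⇒> q≰r , refl

∈range1 : ∀ {y} k → 1 ≤ y → y ≤ k → y ∈ range1 k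
∈range1 zero (s≤s _) ()
∈range1 {y} (suc k) 1≤y y≤1+k with m≤n⇒m<n∨m≡n y≤1+k
... | inj₁ (s≤s y≤k) = ∈-++⁺ˡ (∈range1 k 1≤y y≤k)
... | inj₂ refl = ∈-++⁺ʳ (range1 k) (here refl)

∈⇒∣lcmList : ∀ {x} xs → x ∈ xs → x ∣ lcmList xs
∈⇒∣lcmList (y ∷ ys) (here refl) = m∣lcm[m,n] y (lcmList ys)
∈⇒∣lcmList (y ∷ ys) (there x∈ys) = ∣-trans (∈⇒∣lcmList ys x∈ys) (n∣lcm[m,n] y (lcmList ys))

∣lcmGrid : ∀ q {α α₁ t γ} → 1 ≤ t → t ≤ α → 1 ≤ γ → γ ≤ α₁ → q t γ ∣ lcmGrid q α α₁
∣lcmGrid q {α} {α₁} {t} 1≤t t≤α 1≤γ γ≤α₁ = ∈⇒∣lcmList _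
  (∈-concatMap⁺ (λ t → map (q t) (range1 α₁))
    (lose (∈range1 α 1≤t t≤α) (∈-map⁺ (q t) (∈range1 α₁ 1≤γ γ≤α₁))))

composite[X+r]⇒¬prime[X*k+r] : ∀ {ℓ X k r} → .{{NonZero k}} → Prime ℓ → ℓ ∣ X + r → ℓ ∣ k ∸ 1 →
  Composite (X + r) → ¬ Prime (X * k + r)
composite[X+r]⇒¬prime[X*k+r] {ℓ} {X} {suc k} {r} ℓ-prime ℓ∣X+r ℓ∣k X+r-composite q-prime =
  prime⇒¬composite q-prime (subst Composite (sym q≡X+r) X+r-composite)
  where
  open ≡-Reasoning
  q = X * suc k + r
  q≡ : q ≡ X * k + (X + r)
  q≡ = begin
    X * suc k + r    ≡⟨ cong (_+ r) (*-suc X k) ⟩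
    X + X * k + r    ≡⟨ cong (_+ r) (+-comm X (X * k)) ⟩
    X * k + X + r    ≡⟨ +-assoc (X * k) X r ⟩
    X * k + (X + r)  ∎
  ℓ≡q : ℓ ≡ q
  ℓ≡q = prime∣prime⇒≡ ℓ-prime q-prime
          (subst (ℓ ∣_) (sym q≡) (∣m∣n⇒∣m+n (∣n⇒∣m*n X ℓ∣k) ℓ∣X+r))
  q≡X+r : q ≡ X + r
  q≡X+r = ≤-antisym (∣⇒≤ {{composite⇒nonZero X+r-composite}} (subst (_∣ X + r) ℓ≡q ℓ∣X+r))
                    (subst (X + r ≤_) (sym q≡) (m≤n+m (X + r) (X * k)))

-- q ∸ r is even (q = 2 would force r = 1 and p ∣ 1), so the 2-part of q ∸ r is non-trivial;
-- its odd part is divisible by p, so its p-part is non-trivial too.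
shifted-prime-shape : ∀ {q r p α α₁ R} → Prime q → Prime p → r < q → 2 ∣ r + 1 → 2 ∣ p + 1 →
  2 ∤ R → p ∤ R → p ∣ q ∸ r → q ∸ r ∣ 2 ^ α * p ^ α₁ * R →
  ∃[ t ] ∃[ γ ] ∃[ k ] (1 ≤ t × t ≤ α × 1 ≤ γ × γ ≤ α₁ × k ∣ R × q ≡ 2 ^ t * p ^ γ * k + r)
shifted-prime-shape {q} {r} {p} {α} {α₁} {R} q-prime p-prime r<q r-odd p-odd 2∤R p∤R p∣q∸r q∸r∣n
  with prime⇒≡2⊎odd q-prime
... | inj₁ refl = ⊥-elim (prime∤1 p-prime (subst (p ∣_) (2∸r≡1 r<q r-odd) p∣q∸r))
  where
  2∸r≡1 : ∀ {r} → r < 2 → 2 ∣ r + 1 → 2 ∸ r ≡ 1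
  2∸r≡1 (s≤s z≤n) 2∣1 = ⊥-elim (prime∤1 prime[2] 2∣1)
  2∸r≡1 (s≤s (s≤s z≤n)) _ = refl
... | inj₂ q-odd = shape
  where
  2∤p : 2 ∤ p
  2∤p 2∣p = even⇒¬odd 2∣p p-odd

  p∤2^ : ∀ t → p ∤ 2 ^ t
  p∤2^ t p∣2^t =
    2∤p (subst (2 ∣_) (sym (prime∣prime⇒≡ p-prime prime[2] (prime∣^⇒∣ t p-prime p∣2^t))) ∣-refl)

  shape : ∃[ t ] ∃[ γ ] ∃[ k ] (1 ≤ t × t ≤ α × 1 ≤ γ × γ ≤ α₁ × k ∣ R × q ≡ 2 ^ t * p ^ γ * k + r)
  shape with ∣p^a*m⇒≡p^[t≥1]*d α prime[2] (prime∤* prime[2] (2∤p ∘ prime∣^⇒∣ α₁ prime[2]) 2∤R)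
               (odd∸odd-even (<⇒≤ r<q) q-odd r-odd)
               (subst (q ∸ r ∣_) (*-assoc (2 ^ α) (p ^ α₁) R) q∸r∣n)
  ... | t , d , 1≤t , t≤α , q∸r≡2^t*d , d∣p^α₁*R
    with euclidsLemma (2 ^ t) d p-prime (subst (p ∣_) q∸r≡2^t*d p∣q∸r)
  ... | inj₁ p∣2^t = ⊥-elim (p∤2^ t p∣2^t)
  ... | inj₂ p∣d with ∣p^a*m⇒≡p^[t≥1]*d α₁ p-prime p∤R p∣d d∣p^α₁*R
  ...   | γ , k , 1≤γ , γ≤α₁ , refl , k∣R = t , γ , k , 1≤t , t≤α , 1≤γ , γ≤α₁ , k∣R , q≡
    where
    open ≡-Reasoning
    q≡ : q ≡ 2 ^ t * p ^ γ * k + r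
    q≡ = begin
      q                        ≡⟨ m∸n+n≡m (<⇒≤ r<q) ⟨
      q ∸ r + r                ≡⟨ cong (_+ r) q∸r≡2^t*d ⟩
      2 ^ t * (p ^ γ * k) + r  ≡⟨ cong (_+ r) (*-assoc (2 ^ t) (p ^ γ) k) ⟨
      2 ^ t * p ^ γ * k + r    ∎

prime∣schemmel⇒∣shift : ∀ {r m n p} → .{{NonZero n}} → Prime p → SchemmelValue r m n → p ∣ n →
  ∃[ q ] (Prime q × r < q × (p ≡ q ⊎ p ∣ q ∸ r) × q ∸ r ∣ n)
prime∣schemmel⇒∣shift {r} {n = n} {p} p-prime (fs , (fs-primes , _) , S[fs]≡n) p∣n
  with prime∣product-map⇒∣ (schemmelPP r) fs p-prime (subst (p ∣_) (sym S[fs]≡n) p∣n)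
... | (q , b) , qb∈fs , p∣S = q , q-prime , r<q , p≡q⊎p∣q∸r , q∸r∣n
  where
  q-prime : Prime q
  q-prime = All.lookup fs-primes qb∈fs
  S∣n : schemmelPP r (q , b) ∣ n
  S∣n = subst (_ ∣_) S[fs]≡n (∈⇒∣product (∈-map⁺ (schemmelPP r) qb∈fs))
  r<q×S≡ : r < q × schemmelPP r (q , b) ≡ q ^ (b ∸ 1) * (q ∸ r)
  r<q×S≡ = schemmelPP≢0 r q b (≢-nonZero⁻¹ _ {{divisor≢0 S∣n}})
  r<q : r < q
  r<q = proj₁ r<q×S≡
  S≡ : schemmelPP r (q , b) ≡ q ^ (b ∸ 1) * (q ∸ r)
  S≡ = proj₂ r<q×S≡
  q∸r∣n : q ∸ r ∣ n
  q∸r∣n = ∣-trans (n∣m*n (q ^ (b ∸ 1))) (subst (_∣ n) S≡ S∣n)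
  p≡q⊎p∣q∸r : p ≡ q ⊎ p ∣ q ∸ r
  p≡q⊎p∣q∸r with euclidsLemma (q ^ (b ∸ 1)) (q ∸ r) p-prime (subst (p ∣_) S≡ p∣S)
  ... | inj₁ p∣q^ = inj₁ (prime∣prime⇒≡ p-prime q-prime (prime∣^⇒∣ (b ∸ 1) p-prime p∣q^))
  ... | inj₂ p∣q∸r = inj₂ p∣q∸r

theorem3p2 : (r : ℕ) → 1 ≤ r → 2 ∣ r + 1 →
    (α p₁ α₁ : ℕ) → (rest : List (ℕ × ℕ)) →
    1 ≤ α → 1 ≤ α₁ → Prime p₁ → 2 ∣ p₁ + 1 → r < p₁ →
    All (λ pa → Prime (proj₁ pa) × 2 ∣ proj₁ pa + 1 × r < proj₁ pa × 1 ≤ proj₂ pa) rest →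
    Unique (p₁ ∷ map proj₁ rest) →
    (∀ t γ → 1 ≤ t → t ≤ α → 1 ≤ γ → γ ≤ α₁ → Composite (2 ^ t * p₁ ^ γ + r)) →
    (q : ℕ → ℕ → ℕ) →
    (∀ t γ → 1 ≤ t → t ≤ α → 1 ≤ γ → γ ≤ α₁ →
      Prime (q t γ) × q t γ ∣ 2 ^ t * p₁ ^ γ + r) →
    All (λ pa → lcmGrid q α α₁ ∣ proj₁ pa ∸ 1) rest →
    (p₁ ∸ r) ∤ (2 ^ α * p₁ ^ α₁ * factValue rest) →
    SchemmelNontotient r (2 ^ α * p₁ ^ α₁ * factValue rest)
theorem3p2 r _ r-odd α p₁ α₁ rest _ 1≤α₁ p₁-prime p₁-odd _ rest-ok p₁∉rest
           X+r-composite q q-ok M∣rest p₁∸r∤n (_ , _ , S[m]≡n) =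
  refute (prime∣schemmel⇒∣shift p₁-prime S[m]≡n p₁∣n)
  where
  R n : ℕ
  R = factValue rest
  n = 2 ^ α * p₁ ^ α₁ * R
  rest-primes : All (Prime ∘ proj₁) rest
  rest-primes = All.map proj₁ rest-ok
  instance
    p₁≢0 : NonZero p₁
    p₁≢0 = prime⇒nonZero p₁-prime
    R≢0 : NonZero R
    R≢0 = factValue≢0 rest rest-primes
    n≢0 : NonZero n
    n≢0 = m*n≢0 _ R {{m*n≢0 (2 ^ α) (p₁ ^ α₁) {{m^n≢0 2 α}} {{m^n≢0 p₁ α₁}}}}

  p₁∣n : p₁ ∣ n
  p₁∣n = ∣m⇒∣m*n R (∣n⇒∣m*n (2 ^ α) (n∣n^[1+] 1≤α₁))

  2∤R : 2 ∤ R
  2∤R 2∣R with ∈-map⁻ proj₁ (prime∣factValue⇒∈ rest prime[2] rest-primes 2∣R)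
  ... | _ , pa∈rest , refl = even⇒¬odd ∣-refl (proj₁ (proj₂ (All.lookup rest-ok pa∈rest)))

  p₁∤R : p₁ ∤ R
  p₁∤R = Unique[x∷xs]⇒x∉xs p₁∉rest ∘ prime∣factValue⇒∈ rest p₁-prime rest-primes

  refute : ∃[ q′ ] (Prime q′ × r < q′ × (p₁ ≡ q′ ⊎ p₁ ∣ q′ ∸ r) × q′ ∸ r ∣ n) → ⊥
  refute (_ , _ , _ , inj₁ refl , p₁∸r∣n) = p₁∸r∤n p₁∸r∣n
  refute (_ , q′-prime , r<q′ , inj₂ p₁∣q′∸r , q′∸r∣n)
    with shifted-prime-shape {α = α} {α₁} q′-prime p₁-prime r<q′ r-odd p₁-odd 2∤R p₁∤R
                             p₁∣q′∸r q′∸r∣n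
  ... | t , γ , k , 1≤t , t≤α , 1≤γ , γ≤α₁ , k∣R , refl =
    composite[X+r]⇒¬prime[X*k+r] {X = 2 ^ t * p₁ ^ γ} {{divisor≢0 k∣R}} (proj₁ q-ok′) (proj₂ q-ok′)
      (∣-trans (∣lcmGrid q {α} {α₁} 1≤t t≤α 1≤γ γ≤α₁) (∣∸1-∣factValue rest rest-primes M∣rest k∣R))
      (X+r-composite t γ 1≤t t≤α 1≤γ γ≤α₁) q′-prime
    where
    q-ok′ : Prime (q t γ) × q t γ ∣ 2 ^ t * p₁ ^ γ + r
    q-ok′ = q-ok t γ 1≤t t≤α 1≤γ γ≤α₁
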